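{- Let $H$ be any minimal solution to $k$-DST. Then every vertex $v\in V(H)$ has indegree in $H$ exactly $\lambda(v)$, where $\lambda(v)$ is the maximum number of edge-disjoint directed $r,v$-paths in $H$.
   Context: An instance of $k$-DST consists of a directed graph $G$ with edge costs, a root vertex $r$, a set of terminals $T\subseteq V(G)$ and an integer $k\ge1$. A feasible solution is a subgraph $H\subseteq G$ that contains $k$ pairwise edge-disjoint directed $r,t$-paths for every $t\in T$. A minimal solution is a feasible solution $H$ such that for every edge $e\in E(H)$, the graph $H\setminus e$ is not feasible. -}

module Defs where

open import Data.Nat using (ℕ; zero; suc; _≤_; _+_)
open import Data.Fin using (Fin; _≟_)
open import Data.Bool using (Bool; true; false; if_then_else_)
open import Data.List using (List; []; _∷_; allFin; map)
open import Data.Nat.ListAction using (sum)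
open import Data.List.Membership.Propositional using (_∈_)
open import Data.List.Relation.Unary.All using (All)
open import Data.List.Relation.Unary.Unique.Propositional using (Unique)
open import Data.Product using (Σ; ∃; _×_)
open import Data.Empty using (⊥)
open import Relation.Nullary using (¬_; yes; no)
open import Relation.Nullary.Decidable using (⌊_⌋)
open import Relation.Binary.PropositionalEquality using (_≡_; _≢_)
open import Data.Bool using (_∧_)

record Digraph : Set where
  field
    n   : ℕ
    m   : ℕ
    src : Fin m → Fin n
    tgt : Fin m → Fin n
open Digraph public

Vertex : Digraph → Set
Vertex G = Fin (n G)

Edge : Digraph → Set
Edge G = Fin (m G)

-- A subgraph H ⊆ G, given by its edge set.
EdgeSet : Digraph → Set
EdgeSet G = Edge G → Bool

remove : (G : Digraph) → EdgeSet G → Edge G → EdgeSet G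
remove G H e e' with e ≟ e'
... | yes _ = false
... | no _  = H e'

IsWalk : (G : Digraph) → Vertex G → Vertex G → List (Edge G) → Set
IsWalk G s t []       = s ≡ t
IsWalk G s t (e ∷ es) = (src G e ≡ s) × IsWalk G (tgt G e) t es

walkVerts : (G : Digraph) → Vertex G → List (Edge G) → List (Vertex G)
walkVerts G s []       = s ∷ []
walkVerts G s (e ∷ es) = s ∷ walkVerts G (tgt G e) es

IsPathIn : (G : Digraph) → EdgeSet G → Vertex G → Vertex G → List (Edge G) → Set
IsPathIn G H s t es =
  IsWalk G s t es × Unique (walkVerts G s es) × All (λ e → H e ≡ true) es

EdgeDisjointPaths : (G : Digraph) → EdgeSet G → Vertex G → Vertex G →
                    (j : ℕ) → (Fin j → List (Edge G)) → Set
EdgeDisjointPaths G H s t j P =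
  ((i : Fin j) → IsPathIn G H s t (P i)) ×
  ((i i' : Fin j) → i ≢ i' → (e : Edge G) → e ∈ P i → e ∈ P i' → ⊥)

HasEDPaths : (G : Digraph) → EdgeSet G → Vertex G → Vertex G → ℕ → Set
HasEDPaths G H s t j = Σ (Fin j → List (Edge G)) (EdgeDisjointPaths G H s t j)

IsMaxEDPaths : (G : Digraph) → EdgeSet G → Vertex G → Vertex G → ℕ → Set
IsMaxEDPaths G H s t l =
  HasEDPaths G H s t l × ((j : ℕ) → HasEDPaths G H s t j → j ≤ l)

Feasible : (G : Digraph) → Vertex G → (Vertex G → Bool) → ℕ → EdgeSet G → Set
Feasible G r T k H = (t : Vertex G) → T t ≡ true → HasEDPaths G H r t k

Minimal : (G : Digraph) → Vertex G → (Vertex G → Bool) → ℕ → EdgeSet G → Set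
Minimal G r T k H =
  Feasible G r T k H ×
  ((e : Edge G) → H e ≡ true → ¬ Feasible G r T k (remove G H e))

InV : (G : Digraph) → EdgeSet G → Vertex G → Set
InV G H v = ∃ λ e → (H e ≡ true) × ((src G e ≡ v) Data.Sum.⊎ (tgt G e ≡ v))
  where import Data.Sum

indeg : (G : Digraph) → EdgeSet G → Vertex G → ℕ
indeg G H v = sum (map (λ e → if H e ∧ ⌊ tgt G e ≟ v ⌋ then 1 else 0) (allFin (m G)))

-- Menger's theorem (edge version) yields ℓ = λ(v) edge-disjoint r,v-paths together with
-- a cut X (r ∈ X, v ∉ X) left by at most ℓ edges of H.  Then:
--  * λ(v) ≤ indeg v, because edge-disjoint r,v-paths end with distinct edges into v
--    (weak duality for the cut V ∖ {v});
--  * indeg v ≤ ℓ: by minimality every edge e of H leaves a tight cut Y, one separating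
--    r from a terminal and left by exactly k edges.  If e enters v from outside X,
--    submodularity of cuts lets X grow to X ∪ Y without exceeding ℓ; once no edge enters
--    v from outside X, all edges into v leave X, so indeg v ≤ ℓ.

module Submission where

open import Defs
open import Data.Nat using (ℕ; zero; suc; _≤_; _<_; _+_; z≤n; s≤s; _≤?_)
open import Data.Nat.Properties hiding (_≟_)
open import Data.Bool using (Bool; true; false; if_then_else_; _∧_; _∨_; not)
open import Data.Fin using (Fin; zero; suc; _≟_; inject≤)
open import Data.List using (List; []; _∷_; allFin; map; _++_)
open import Data.List.Properties using (map-tabulate; map-cong)
open import Data.Nat.ListAction using (sum)
open import Data.Product using (Σ; _×_; _,_; proj₁; proj₂)
open import Data.Sum using (_⊎_; inj₁; inj₂)
open import Data.Empty using (⊥; ⊥-elim)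
open import Data.Unit using (tt)
open import Relation.Nullary using (¬_; yes; no)
open import Relation.Nullary.Decidable using (⌊_⌋)
open import Relation.Binary.PropositionalEquality
open import Function using (_∘_; id)
open import Function.Definitions using (Injective)
import Data.Fin.Properties as Finₚ
import Data.Bool.Properties as Boolₚ
open import Data.List.Membership.Propositional using (_∈_)
open import Data.List.Relation.Unary.Any using (here; there)
open import Data.List.Relation.Unary.All using (All; []; _∷_) renaming (map to All-map; lookup to All-lookup)
open import Data.List.Relation.Unary.All.Properties using (¬Any⇒All¬; All¬⇒¬Any; ++⁺)
open import Data.List.Relation.Unary.AllPairs using ([]; _∷_)
open import Data.List.Relation.Unary.Unique.Propositional using (Unique)
open import Data.List.Membership.Propositional.Properties using (∈-map⁻)
open import Data.Nat.Tactic.RingSolver using (solve-∀)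

𝟙 : Bool → ℕ
𝟙 b = if b then 1 else 0

𝟙≤1 : ∀ b → 𝟙 b ≤ 1
𝟙≤1 true  = s≤s z≤n
𝟙≤1 false = z≤n

𝟙-∧≤ : ∀ a b → 𝟙 (a ∧ b) ≤ 𝟙 a
𝟙-∧≤ true  b = 𝟙≤1 b
𝟙-∧≤ false b = z≤n

𝟙-∨≤ : ∀ a b → 𝟙 a ≤ 𝟙 (a ∨ b)
𝟙-∨≤ true  b = ≤-refl
𝟙-∨≤ false b = z≤n

𝟙-∨< : ∀ {a b} → a ≡ false → b ≡ true → 𝟙 a < 𝟙 (a ∨ b)
𝟙-∨< refl refl = s≤s z≤n

≟-true : ∀ {k} (x y : Fin k) → x ≡ y → ⌊ x ≟ y ⌋ ≡ true
≟-true x y x≡y with x ≟ y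
... | yes _   = refl
... | no x≢y = ⊥-elim (x≢y x≡y)

≟-true⁻ : ∀ {k} (x y : Fin k) → ⌊ x ≟ y ⌋ ≡ true → x ≡ y
≟-true⁻ x y eq with x ≟ y
≟-true⁻ x y eq  | yes x≡y = x≡y
≟-true⁻ x y () | no _

true≢false : true ≢ false
true≢false ()

∨-true⁻ : ∀ a {b} → a ∨ b ≡ true → (a ≡ true) ⊎ (b ≡ true)
∨-true⁻ true  _  = inj₁ refl
∨-true⁻ false eq = inj₂ eq

-- The pattern  a ∧ b ∧ not c  describes an edge crossing out of a set.
crossing⁻ : ∀ a b c → a ∧ b ∧ not c ≡ true → (a ≡ true) × (b ≡ true) × (c ≡ false)
crossing⁻ true true false refl = refl , refl , refl

entering⁻ : ∀ a b c → a ∧ not b ∧ c ≡ true → (a ≡ true) × (b ≡ false) × (c ≡ true)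
entering⁻ true false true refl = refl , refl , refl

non-crossing⁻ : ∀ {a b c} → a ∧ b ∧ not c ≡ false → a ≡ true → b ≡ true → c ≡ true
non-crossing⁻ {c = true}  _  refl refl = refl
non-crossing⁻ {c = false} () refl refl

count : (m : ℕ) → (Fin m → ℕ) → ℕ
count m g = sum (map g (allFin m))

count-suc : ∀ m (g : Fin (suc m) → ℕ) → count (suc m) g ≡ g zero + count m (g ∘ suc)
count-suc m g = cong (λ l → g zero + sum l)
  (trans (map-tabulate suc g) (sym (map-tabulate id (g ∘ suc))))

count-cong : ∀ m {g h : Fin m → ℕ} → (∀ x → g x ≡ h x) → count m g ≡ count m h
count-cong m g≗h = cong sum (map-cong g≗h (allFin m))

count-zero : ∀ m (g : Fin m → ℕ) → (∀ x → g x ≡ 0) → count m g ≡ 0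
count-zero zero    g g≗0 = refl
count-zero (suc m) g g≗0 rewrite count-suc m g | g≗0 zero = count-zero m (g ∘ suc) (g≗0 ∘ suc)

count-mono : ∀ m (g h : Fin m → ℕ) → (∀ x → g x ≤ h x) → count m g ≤ count m h
count-mono zero    g h g≤h = z≤n
count-mono (suc m) g h g≤h rewrite count-suc m g | count-suc m h =
  +-mono-≤ (g≤h zero) (count-mono m (g ∘ suc) (h ∘ suc) (g≤h ∘ suc))

count-strict : ∀ m (g h : Fin m → ℕ) → (∀ x → g x ≤ h x) → (x : Fin m) → g x < h x →
               count m g < count m h
count-strict (suc m) g h g≤h zero lt rewrite count-suc m g | count-suc m h =
  +-mono-<-≤ lt (count-mono m (g ∘ suc) (h ∘ suc) (g≤h ∘ suc))
count-strict (suc m) g h g≤h (suc x) lt rewrite count-suc m g | count-suc m h =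
  +-mono-≤-< (g≤h zero) (count-strict m (g ∘ suc) (h ∘ suc) (g≤h ∘ suc) x lt)

count-+ : ∀ m (g h : Fin m → ℕ) → count m (λ x → g x + h x) ≡ count m g + count m h
count-+ zero    g h = refl
count-+ (suc m) g h
  rewrite count-suc m (λ x → g x + h x) | count-suc m g | count-suc m h | count-+ m (g ∘ suc) (h ∘ suc) =
  interchange (g zero) (h zero) _ _
  where
  interchange : ∀ a b c d → a + b + (c + d) ≡ a + c + (b + d)
  interchange = solve-∀

count-update : ∀ m (g g' : Fin m → ℕ) (e : Fin m) → (∀ x → x ≢ e → g x ≡ g' x) →
               count m g' + g e ≡ count m g + g' e
count-update (suc m) g g' zero agree
  rewrite count-suc m g | count-suc m g' | count-cong m (λ x → agree (suc x) (λ ())) =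
  swap (g' zero) _ (g zero)
  where
  swap : ∀ a b c → a + b + c ≡ c + b + a
  swap = solve-∀
count-update (suc m) g g' (suc e) agree
  rewrite count-suc m g | count-suc m g' | agree zero (λ ()) = begin
    g' zero + count m (g' ∘ suc) + g (suc e)   ≡⟨ +-assoc (g' zero) _ _ ⟩
    g' zero + (count m (g' ∘ suc) + g (suc e)) ≡⟨ cong (g' zero +_) shifted ⟩
    g' zero + (count m (g ∘ suc) + g' (suc e)) ≡⟨ +-assoc (g' zero) _ _ ⟨
    g' zero + count m (g ∘ suc) + g' (suc e)   ∎
  where
  open ≡-Reasoning
  shifted : count m (g' ∘ suc) + g (suc e) ≡ count m (g ∘ suc) + g' (suc e)
  shifted = count-update m (g ∘ suc) (g' ∘ suc) e (λ x x≢e → agree (suc x) (x≢e ∘ Finₚ.suc-injective))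

count-𝟙≤ : ∀ m (p : Fin m → Bool) → count m (𝟙 ∘ p) ≤ m
count-𝟙≤ zero    p = z≤n
count-𝟙≤ (suc m) p rewrite count-suc m (𝟙 ∘ p) = +-mono-≤ (𝟙≤1 (p zero)) (count-𝟙≤ m (p ∘ suc))

count-injection : ∀ m j (f : Fin j → Fin m) → Injective _≡_ _≡_ f →
                  (p : Fin m → Bool) → (∀ i → p (f i) ≡ true) → j ≤ count m (𝟙 ∘ p)
count-injection m zero    f f-inj p pf = z≤n
count-injection m (suc j) f f-inj p pf =
  ≤-trans (s≤s (count-injection m j (f ∘ suc) (Finₚ.suc-injective ∘ f-inj) p' p'f))
          (count-strict m (𝟙 ∘ p') (𝟙 ∘ p) (λ y → 𝟙-∧≤ (p y) _) x dropped)
  where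
  x : Fin m
  x = f zero
  p' : Fin m → Bool
  p' y = p y ∧ not ⌊ y ≟ x ⌋
  p'f : ∀ i → p' (f (suc i)) ≡ true
  p'f i with f (suc i) ≟ x
  ... | yes eq = ⊥-elim (Finₚ.0≢1+n (sym (f-inj eq)))
  ... | no _   = trans (Boolₚ.∧-identityʳ _) (pf (suc i))
  dropped : 𝟙 (p' x) < 𝟙 (p x)
  dropped rewrite ≟-true x x refl | pf zero = s≤s z≤n

VSet : Digraph → Set
VSet G = Vertex G → Bool

_∪_ _∩_ : {V : Set} → (V → Bool) → (V → Bool) → V → Bool
(X ∪ Y) x = X x ∨ Y x
(X ∩ Y) x = X x ∧ Y x

module _ (G : Digraph) where

  leaves enters : EdgeSet G → VSet G → Edge G → Bool
  leaves F X e = F e ∧ X (src G e) ∧ not (X (tgt G e))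
  enters F X e = F e ∧ not (X (src G e)) ∧ X (tgt G e)

  δ⁺ δ⁻ : EdgeSet G → VSet G → ℕ
  δ⁺ F X = count (m G) (𝟙 ∘ leaves F X)
  δ⁻ F X = count (m G) (𝟙 ∘ enters F X)

  walk-leaves : (F : EdgeSet G) (X : VSet G) {a b : Vertex G} (es : List (Edge G)) →
                IsWalk G a b es → X a ≡ true → X b ≡ false → All (λ e → F e ≡ true) es →
                Σ (Edge G) λ e → e ∈ es × leaves F X e ≡ true
  walk-leaves F X [] refl Xa Xb _ = ⊥-elim (true≢false (trans (sym Xa) Xb))
  walk-leaves F X (e ∷ es) (src≡a , walk) Xa Xb (Fe ∷ Fes) with X (tgt G e) in Xt
  ... | true  = let (e' , e'∈es , e'-leaves) = walk-leaves F X es walk Xt Xb Fes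
                in e' , there e'∈es , e'-leaves
  ... | false = e , here refl , e-leaves
    where
    e-leaves : leaves F X e ≡ true
    e-leaves rewrite Fe | src≡a | Xa | Xt = refl

  -- Weak duality: j edge-disjoint s,t-paths in F need j distinct F-edges leaving
  -- any vertex set containing s but not t.
  paths≤cut : (F : EdgeSet G) (X : VSet G) {s t : Vertex G} {j : ℕ} →
              HasEDPaths G F s t j → X s ≡ true → X t ≡ false → j ≤ δ⁺ F X
  paths≤cut F X {j = j} (P , paths , disjoint) Xs Xt =
    count-injection (m G) j exit exit-injective (leaves F X) (proj₂ ∘ proj₂ ∘ crossing)
    where
    crossing : ∀ i → Σ (Edge G) λ e → e ∈ P i × leaves F X e ≡ true
    crossing i = let (walk , _ , inF) = paths i in walk-leaves F X (P i) walk Xs Xt inF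
    exit : Fin j → Edge G
    exit = proj₁ ∘ crossing
    exit-injective : Injective _≡_ _≡_ exit
    exit-injective {i} {i'} same with i ≟ i'
    ... | yes i≡i' = i≡i'
    ... | no i≢i'  = ⊥-elim (disjoint i i' i≢i' (exit i) (proj₁ (proj₂ (crossing i)))
                              (subst (_∈ P i') (sym same) (proj₁ (proj₂ (crossing i')))))

  size : VSet G → ℕ
  size X = count (n G) (𝟙 ∘ X)

  size≤n : ∀ X → size X ≤ n G
  size≤n X = count-𝟙≤ (n G) X

  size-∪-grows : ∀ X Y x → X x ≡ false → Y x ≡ true → size X < size (X ∪ Y)
  size-∪-grows X Y x Xx Yx = count-strict (n G) _ _ (λ y → 𝟙-∨≤ (X y) (Y y)) x (𝟙-∨< Xx Yx)

ascend : {S A : Set} (μ : S → ℕ) (B : ℕ) → (∀ s → μ s ≤ B) →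
         (∀ s → A ⊎ Σ S (λ s' → μ s < μ s')) → S → A
ascend {S} {A} μ B bounded step s₀ = run (suc B) s₀ (m≤n+m (suc B) (μ s₀))
  where
  -- invariant: the measure cannot increase fuel more times without exceeding B
  run : (fuel : ℕ) (s : S) → B < μ s + fuel → A
  run zero s B<μ = ⊥-elim (<⇒≱ (subst (B <_) (+-identityʳ (μ s)) B<μ) (bounded s))
  run (suc fuel) s B<μ with step s
  ... | inj₁ a = a
  ... | inj₂ (s' , μ<μ') = run fuel s' (≤-trans B<μ (begin
          μ s + suc fuel   ≡⟨ +-suc (μ s) fuel ⟩
          suc (μ s) + fuel ≤⟨ +-monoˡ-≤ fuel μ<μ' ⟩
          μ s' + fuel      ∎))
    where open ≤-Reasoning

fin-dichotomy : ∀ {k} {A B : Fin k → Set} → (∀ x → A x ⊎ B x) → (∀ x → A x) ⊎ Σ (Fin k) B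
fin-dichotomy {zero}  _  = inj₁ (λ ())
fin-dichotomy {suc k} ab with ab zero | fin-dichotomy (ab ∘ suc)
... | inj₂ b | _            = inj₂ (zero , b)
... | inj₁ a | inj₂ (x , b) = inj₂ (suc x , b)
... | inj₁ a | inj₁ as      = inj₁ λ { zero → a ; (suc x) → as x }

search : ∀ {k} (b : Fin k → Bool) → (∀ x → b x ≡ false) ⊎ Σ (Fin k) (λ x → b x ≡ true)
search b = fin-dichotomy (λ x → outcome (b x))
  where
  outcome : ∀ c → (c ≡ false) ⊎ (c ≡ true)
  outcome false = inj₁ refl
  outcome true  = inj₂ refl

-- Walks that may traverse edges backwards, as used in residual graphs.

data Dir : Set where
  fwd bwd : Dir

Step : Digraph → Set
Step G = Edge G × Dir

module _ (G : Digraph) where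

  from to : Step G → Vertex G
  from (e , fwd) = src G e
  from (e , bwd) = tgt G e
  to   (e , fwd) = tgt G e
  to   (e , bwd) = src G e

  StepWalk : Vertex G → Vertex G → List (Step G) → Set
  StepWalk a b []       = a ≡ b
  StepWalk a b (st ∷ l) = (from st ≡ a) × StepWalk (to st) b l

  stepVerts : Vertex G → List (Step G) → List (Vertex G)
  stepVerts a []       = a ∷ []
  stepVerts a (st ∷ l) = a ∷ stepVerts (to st) l

  Simple : Vertex G → List (Step G) → Set
  Simple a l = Unique (stepVerts a l)

  stepWalk-snoc : {a b : Vertex G} (l : List (Step G)) (st : Step G) →
                  StepWalk a b l → from st ≡ b → StepWalk a (to st) (l ++ st ∷ [])
  stepWalk-snoc []       st refl from≡b = from≡b , refl
  stepWalk-snoc (_ ∷ l) st (f , w) from≡b = f , stepWalk-snoc l st w from≡b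

  step-endpoints : {c b : Vertex G} (l : List (Step G)) (st : Step G) → StepWalk c b l → st ∈ l →
                   (from st ∈ stepVerts c l) × (to st ∈ stepVerts c l)
  step-endpoints (_ ∷ l) st (f , w) (here refl) = here f , there (start-visited l w)
    where
    start-visited : ∀ {c d} l → StepWalk c d l → c ∈ stepVerts c l
    start-visited []      _ = here refl
    start-visited (_ ∷ _) _ = here refl
  step-endpoints (_ ∷ l) st (f , w) (there st∈l) =
    let (f∈ , t∈) = step-endpoints l st w st∈l in there f∈ , there t∈

  from-endpoint : (e : Edge G) (d d' : Dir) → (from (e , d) ≡ from (e , d')) ⊎ (from (e , d) ≡ to (e , d'))
  from-endpoint e fwd fwd = inj₁ refl
  from-endpoint e fwd bwd = inj₂ refl
  from-endpoint e bwd fwd = inj₂ refl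
  from-endpoint e bwd bwd = inj₁ refl

  simple⇒edges-unique : {a b : Vertex G} (l : List (Step G)) → StepWalk a b l → Simple a l →
                        Unique (map proj₁ l)
  simple⇒edges-unique [] _ _ = []
  simple⇒edges-unique {a} ((e , d) ∷ l) (from≡a , w) (a∉rest ∷ simple) =
    ¬Any⇒All¬ _ e∉l ∷ simple⇒edges-unique l w simple
    where
    revisit : ∀ {x} → x ∈ stepVerts (to (e , d)) l → a ≡ x → ⊥
    revisit x∈ refl = All¬⇒¬Any a∉rest x∈
    e∉l : ¬ (e ∈ map proj₁ l)
    e∉l e∈ with ∈-map⁻ proj₁ e∈
    ... | ((e , d') , st∈l , refl) with step-endpoints l (e , d') w st∈l | from-endpoint e d d'
    ...   | (f∈ , _) | inj₁ same = revisit f∈ (trans (sym from≡a) same)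
    ...   | (_ , t∈) | inj₂ same = revisit t∈ (trans (sym from≡a) same)

  module _ (P : Step G → Set) where
    open import Data.List.Membership.DecPropositional (_≟_ {n G}) using (_∈?_)

    SimpleWalk : Vertex G → Vertex G → Set
    SimpleWalk a b = Σ (List (Step G)) λ l → StepWalk a b l × Simple a l × All P l

    suffix-from : {a c b : Vertex G} (l : List (Step G)) → StepWalk c b l → Simple c l → All P l →
                  a ∈ stepVerts c l → SimpleWalk a b
    suffix-from []       w s ps (here refl) = [] , w , s , ps
    suffix-from (st ∷ l) w s ps (here refl) = st ∷ l , w , s , ps
    suffix-from (st ∷ l) (_ , w) (_ ∷ s) (_ ∷ ps) (there a∈) = suffix-from l w s ps a∈

    shortcut : {a b : Vertex G} (l : List (Step G)) → StepWalk a b l → All P l → SimpleWalk a b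
    shortcut []       w []       = [] , w , [] ∷ [] , []
    shortcut {a} (st ∷ l) (f , w) (p ∷ ps) with shortcut l w ps
    ... | l' , w' , s' , ps' with a ∈? stepVerts (to st) l'
    ...   | yes a∈ = suffix-from l' w' s' ps' a∈
    ...   | no  a∉ = st ∷ l' , (f , w') , ¬Any⇒All¬ _ a∉ ∷ s' , p ∷ ps'

module _ (G : Digraph) (usable : Step G → Bool) (s : Vertex G) where

  ReachableFrom : VSet G → Set
  ReachableFrom R = ∀ x → R x ≡ true →
    Σ (List (Step G)) λ l → StepWalk G s x l × All (λ st → usable st ≡ true) l

  ClosedUnder : VSet G → Set
  ClosedUnder R = ∀ st → usable st ≡ true → R (from G st) ≡ true → R (to G st) ≡ true

  closed-no-exit : ∀ R → ClosedUnder R → (F : EdgeSet G) → (∀ e → F e ≡ true → usable (e , fwd) ≡ true) →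
                   δ⁺ G F R ≡ 0
  closed-no-exit R closed F usable-fwd = count-zero (m G) _ stays
    where
    stays : ∀ e → 𝟙 (leaves G F R e) ≡ 0
    stays e with leaves G F R e in leaving
    ... | false = refl
    ... | true  = let (Fe , R-src , R-tgt) = crossing⁻ (F e) _ _ leaving
                  in ⊥-elim (true≢false (trans (sym (closed (e , fwd) (usable-fwd e Fe) R-src)) R-tgt))

  closed-no-entry : ∀ R → ClosedUnder R → (F : EdgeSet G) → (∀ e → F e ≡ true → usable (e , bwd) ≡ true) →
                    δ⁻ G F R ≡ 0
  closed-no-entry R closed F usable-bwd = count-zero (m G) _ stays
    where
    stays : ∀ e → 𝟙 (enters G F R e) ≡ 0
    stays e with enters G F R e in entering
    ... | false = refl
    ... | true  = let (Fe , R-src , R-tgt) = entering⁻ (F e) _ _ entering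
                  in ⊥-elim (true≢false (trans (sym (closed (e , bwd) (usable-bwd e Fe) R-tgt)) R-src))

  Closure : Set
  Closure = Σ (VSet G) λ R → (R s ≡ true) × ReachableFrom R × ClosedUnder R

  closure : Closure
  closure = ascend (size G ∘ proj₁) (n G) (size≤n G ∘ proj₁) explore (start , ≟-true s s refl , from-start)
    where
    Partial : Set
    Partial = Σ (VSet G) λ R → (R s ≡ true) × ReachableFrom R

    start : VSet G
    start x = ⌊ x ≟ s ⌋

    from-start : ReachableFrom start
    from-start x x≡s = [] , sym (≟-true⁻ x s x≡s) , []

    exits : VSet G → Step G → Bool
    exits R st = usable st ∧ R (from G st) ∧ not (R (to G st))

    extend : (R : Partial) (st : Step G) → exits (proj₁ R) st ≡ true →
             Σ Partial λ R' → size G (proj₁ R) < size G (proj₁ R')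
    extend (R , Rs , reach) st exit with crossing⁻ (usable st) (R (from G st)) (R (to G st)) exit
    ... | usable-st , R-from , R-to =
      (R ∪ head , Rs' , reach') , size-∪-grows G R head (to G st) R-to head-to
      where
      head : VSet G
      head x = ⌊ x ≟ to G st ⌋
      head-to : head (to G st) ≡ true
      head-to = ≟-true _ _ refl
      Rs' : (R ∪ head) s ≡ true
      Rs' rewrite Rs = refl
      reach' : ReachableFrom (R ∪ head)
      reach' x x∈ with ∨-true⁻ (R x) x∈
      ... | inj₁ x∈R = reach x x∈R
      ... | inj₂ x≡to with ≟-true⁻ x (to G st) x≡to
      ...   | refl with reach (from G st) R-from
      ...     | l , w , us = l ++ st ∷ [] , stepWalk-snoc G l st w refl , ++⁺ us (usable-st ∷ [])

    explore : (R : Partial) → Closure ⊎ Σ Partial λ R' → size G (proj₁ R) < size G (proj₁ R')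
    explore (R , Rs , reach) with search (λ e → exits R (e , fwd)) | search (λ e → exits R (e , bwd))
    ... | inj₂ (e , exit) | _               = inj₂ (extend (R , Rs , reach) (e , fwd) exit)
    ... | inj₁ _          | inj₂ (e , exit) = inj₂ (extend (R , Rs , reach) (e , bwd) exit)
    ... | inj₁ noFwd      | inj₁ noBwd      = inj₁ (R , Rs , reach , closed)
      where
      closed : ClosedUnder R
      closed (e , fwd) = non-crossing⁻ (noFwd e)
      closed (e , bwd) = non-crossing⁻ (noBwd e)

-- Flows.  All capacities are 1, so an integral s,t-flow is an edge set F; its value j
-- is recorded by its effect on every s,t-cut (net outflow j across each of them).

FlowOf : (G : Digraph) → EdgeSet G → Vertex G → Vertex G → ℕ → Set
FlowOf G F s t j = ∀ X → X s ≡ true → X t ≡ false → δ⁺ G F X ≡ δ⁻ G F X + j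

-- A flow F is changed by toggling the edges of a walk of one of two kinds, relative
-- to a capacity graph H ⊇ F:
--  * augmenting walks (residual graph): forward on H-edges outside F, backward on F-edges;
--  * supporting walks: forward on F-edges only (they are deleted from F).
data Mode : Set where
  augmenting supporting : Mode

allowed : Mode → Dir → (inH inF : Bool) → Bool
allowed augmenting fwd h f = not f ∧ h
allowed augmenting bwd h f = f
allowed supporting fwd h f = f
allowed supporting bwd h f = false

-- Toggling a walk from x to y changes the net outflow δ⁺ − δ⁻ of a cut X by
-- 𝟙 (X x) − 𝟙 (X y) for augmenting walks and by its negative for supporting walks.
-- To stay in ℕ this is written  δ⁺ F' + δ⁻ F + tally (X x) (X y) ≡ δ⁻ F' + δ⁺ F + tally (X y) (X x).
tally : Mode → Bool → Bool → ℕ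
tally augmenting x y = 𝟙 y
tally supporting x y = 𝟙 x

tally-telescope : ∀ μ a b c → tally μ a c + tally μ c b + tally μ b a ≡ tally μ c a + tally μ b c + tally μ a b
tally-telescope augmenting a b c = rotate (𝟙 c) (𝟙 b) (𝟙 a)
  where
  rotate : ∀ x y z → x + y + z ≡ z + x + y
  rotate = solve-∀
tally-telescope supporting a b c = rotate (𝟙 a) (𝟙 c) (𝟙 b)
  where
  rotate : ∀ x y z → x + y + z ≡ y + z + x
  rotate = solve-∀

atFrom atTo : Dir → Bool → Bool → Bool
atFrom fwd xs xt = xs
atFrom bwd xs xt = xt
atTo   fwd xs xt = xt
atTo   bwd xs xt = xs

-- The balance for a single allowed step, read off edge by edge: the edge's own
-- leaving/entering indicators before (f) and after (not f) toggling, on a cut with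
-- membership xs, xt of its endpoints.
edge-balance : ∀ μ d h f xs xt → allowed μ d h f ≡ true →
  𝟙 (not f ∧ xs ∧ not xt) + 𝟙 (f ∧ not xs ∧ xt) + tally μ (atFrom d xs xt) (atTo d xs xt) ≡
  𝟙 (not f ∧ not xs ∧ xt) + 𝟙 (f ∧ xs ∧ not xt) + tally μ (atTo d xs xt) (atFrom d xs xt)
edge-balance augmenting fwd h false true  true  _ = refl
edge-balance augmenting fwd h false true  false _ = refl
edge-balance augmenting fwd h false false true  _ = refl
edge-balance augmenting fwd h false false false _ = refl
edge-balance augmenting fwd h true  xs    xt    ()
edge-balance augmenting bwd h true  true  true  _ = refl
edge-balance augmenting bwd h true  true  false _ = refl
edge-balance augmenting bwd h true  false true  _ = refl
edge-balance augmenting bwd h true  false false _ = refl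
edge-balance augmenting bwd h false xs    xt    ()
edge-balance supporting fwd h true  true  true  _ = refl
edge-balance supporting fwd h true  true  false _ = refl
edge-balance supporting fwd h true  false true  _ = refl
edge-balance supporting fwd h true  false false _ = refl
edge-balance supporting fwd h false xs    xt    ()
edge-balance supporting bwd h f     xs    xt    ()

step-balance-arith : ∀ o' o i' i l l' k k' L L' →
  o' + l ≡ o + l' → i' + k ≡ i + k' → l' + k + L ≡ k' + l + L' → o' + i + L ≡ i' + o + L'
step-balance-arith o' o i' i l l' k k' L L' A B C = +-cancelʳ-≡ (l + k') _ _ (begin
    o' + i + L + (l + k')     ≡⟨ regroup₁ o' i L l k' ⟩
    (o' + l) + (i + k') + L   ≡⟨ cong₂ (λ u w → u + w + L) A (sym B) ⟩
    (o + l') + (i' + k) + L   ≡⟨ regroup₂ o l' i' k L ⟩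
    (o + i') + (l' + k + L)   ≡⟨ cong ((o + i') +_) C ⟩
    (o + i') + (k' + l + L')  ≡⟨ regroup₃ o i' k' l L' ⟩
    i' + o + L' + (l + k')    ∎)
  where
  open ≡-Reasoning
  regroup₁ : ∀ o' i L l k' → o' + i + L + (l + k') ≡ (o' + l) + (i + k') + L
  regroup₁ = solve-∀
  regroup₂ : ∀ o l' i' k L → (o + l') + (i' + k) + L ≡ (o + i') + (l' + k + L)
  regroup₂ = solve-∀
  regroup₃ : ∀ o i' k' l L' → (o + i') + (k' + l + L') ≡ i' + o + L' + (l + k')
  regroup₃ = solve-∀

balance-chain : ∀ o₀ i₀ o₁ i₁ o₂ i₂ A A' B B' C C' →
  o₁ + i₀ + A ≡ i₁ + o₀ + A' → o₂ + i₁ + B ≡ i₂ + o₁ + B' → A + B + C' ≡ A' + B' + C →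
  o₂ + i₀ + C ≡ i₂ + o₀ + C'
balance-chain o₀ i₀ o₁ i₁ o₂ i₂ A A' B B' C C' S R T = +-cancelʳ-≡ (o₁ + i₁ + (A + B + C')) _ _ (begin
    o₂ + i₀ + C + (o₁ + i₁ + (A + B + C'))          ≡⟨ regroup₁ o₀ i₀ o₁ i₁ o₂ A B C C' ⟩
    (o₁ + i₀ + A) + (o₂ + i₁ + B) + (C + C')        ≡⟨ cong₂ (λ u w → u + w + (C + C')) S R ⟩
    (i₁ + o₀ + A') + (i₂ + o₁ + B') + (C + C')      ≡⟨ regroup₂ o₀ o₁ i₁ i₂ A' B' C C' ⟩
    i₂ + o₀ + C' + (o₁ + i₁ + (A' + B' + C))        ≡⟨ cong (λ u → i₂ + o₀ + C' + (o₁ + i₁ + u)) (sym T) ⟩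
    i₂ + o₀ + C' + (o₁ + i₁ + (A + B + C'))         ∎)
  where
  open ≡-Reasoning
  regroup₁ : ∀ o₀ i₀ o₁ i₁ o₂ A B C C' →
             o₂ + i₀ + C + (o₁ + i₁ + (A + B + C')) ≡ (o₁ + i₀ + A) + (o₂ + i₁ + B) + (C + C')
  regroup₁ = solve-∀
  regroup₂ : ∀ o₀ o₁ i₁ i₂ A' B' C C' →
             (i₁ + o₀ + A') + (i₂ + o₁ + B') + (C + C') ≡ i₂ + o₀ + C' + (o₁ + i₁ + (A' + B' + C))
  regroup₂ = solve-∀

module _ (G : Digraph) where

  _⊆ₑ_ : EdgeSet G → EdgeSet G → Set
  F ⊆ₑ H = ∀ e → F e ≡ true → H e ≡ true

  count-edit : (F F' : EdgeSet G) (e : Edge G) (π : Edge G → Bool → Bool) → (∀ x → x ≢ e → F x ≡ F' x) →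
               count (m G) (λ x → 𝟙 (π x (F' x))) + 𝟙 (π e (F e)) ≡
               count (m G) (λ x → 𝟙 (π x (F x))) + 𝟙 (π e (F' e))
  count-edit F F' e π agree = count-update (m G) _ _ e (λ x x≢e → cong (λ b → 𝟙 (π x b)) (agree x x≢e))

  toggleEdge : EdgeSet G → Edge G → EdgeSet G
  toggleEdge F e e' = if ⌊ e ≟ e' ⌋ then not (F e') else F e'

  toggleEdge-other : ∀ F e e' → e' ≢ e → toggleEdge F e e' ≡ F e'
  toggleEdge-other F e e' e'≢e with e ≟ e'
  ... | yes e≡e' = ⊥-elim (e'≢e (sym e≡e'))
  ... | no _     = refl

  toggleEdge-same : ∀ F e → toggleEdge F e e ≡ not (F e)
  toggleEdge-same F e rewrite ≟-true e e refl = refl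

  toggle-count : (F : EdgeSet G) (e : Edge G) (π : Edge G → Bool → Bool) →
                 count (m G) (λ x → 𝟙 (π x (toggleEdge F e x))) + 𝟙 (π e (F e)) ≡
                 count (m G) (λ x → 𝟙 (π x (F x))) + 𝟙 (π e (not (F e)))
  toggle-count F e π =
    subst (λ b → count (m G) (λ x → 𝟙 (π x (toggleEdge F e x))) + 𝟙 (π e (F e)) ≡
                 count (m G) (λ x → 𝟙 (π x (F x))) + 𝟙 (π e b))
          (toggleEdge-same F e)
    (count-edit F (toggleEdge F e) e π (λ x x≢e → sym (toggleEdge-other F e x x≢e)))

  toggleWalk : EdgeSet G → List (Step G) → EdgeSet G
  toggleWalk F []            = F
  toggleWalk F ((e , _) ∷ l) = toggleWalk (toggleEdge F e) l

  toggleWalk-other : ∀ F l e' → ¬ (e' ∈ map proj₁ l) → toggleWalk F l e' ≡ F e'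
  toggleWalk-other F []            e' _     = refl
  toggleWalk-other F ((e , _) ∷ l) e' e'∉l =
    trans (toggleWalk-other (toggleEdge F e) l e' (e'∉l ∘ there)) (toggleEdge-other F e e' (e'∉l ∘ here))

  Allowed : Mode → EdgeSet G → EdgeSet G → Step G → Bool
  Allowed μ H F (e , d) = allowed μ d (H e) (F e)

  AllowedWalk : Mode → EdgeSet G → EdgeSet G → List (Step G) → Set
  AllowedWalk μ H F l = All (λ st → Allowed μ H F st ≡ true) l

  allowed-after-toggle : ∀ μ H F e l → All (e ≢_) (map proj₁ l) → AllowedWalk μ H F l →
                         AllowedWalk μ H (toggleEdge F e) l
  allowed-after-toggle μ H F e [] _ [] = []
  allowed-after-toggle μ H F e ((e' , d') ∷ l) (e≢e' ∷ e∉l) (ok ∷ oks) =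
    subst (λ b → allowed μ d' (H e') b ≡ true) (sym (toggleEdge-other F e e' (e≢e' ∘ sym))) ok
    ∷ allowed-after-toggle μ H F e l e∉l oks

  X-from : ∀ (X : VSet G) e d → X (from G (e , d)) ≡ atFrom d (X (src G e)) (X (tgt G e))
  X-from X e fwd = refl
  X-from X e bwd = refl

  X-to : ∀ (X : VSet G) e d → X (to G (e , d)) ≡ atTo d (X (src G e)) (X (tgt G e))
  X-to X e fwd = refl
  X-to X e bwd = refl

  toggle-step-balance : ∀ μ H F e d (X : VSet G) → Allowed μ H F (e , d) ≡ true →
    δ⁺ G (toggleEdge F e) X + δ⁻ G F X + tally μ (X (from G (e , d))) (X (to G (e , d))) ≡
    δ⁻ G (toggleEdge F e) X + δ⁺ G F X + tally μ (X (to G (e , d))) (X (from G (e , d)))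
  toggle-step-balance μ H F e d X ok rewrite X-from X e d | X-to X e d =
    step-balance-arith (δ⁺ G F' X) (δ⁺ G F X) (δ⁻ G F' X) (δ⁻ G F X)
      (𝟙 (F e ∧ xs ∧ not xt)) (𝟙 (not (F e) ∧ xs ∧ not xt))
      (𝟙 (F e ∧ not xs ∧ xt)) (𝟙 (not (F e) ∧ not xs ∧ xt))
      (tally μ (atFrom d xs xt) (atTo d xs xt)) (tally μ (atTo d xs xt) (atFrom d xs xt))
      (toggle-count F e (λ x b → b ∧ X (src G x) ∧ not (X (tgt G x))))
      (toggle-count F e (λ x b → b ∧ not (X (src G x)) ∧ X (tgt G x)))
      (edge-balance μ d (H e) (F e) xs xt ok)
    where
    F' : EdgeSet G
    F' = toggleEdge F e
    xs xt : Bool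
    xs = X (src G e)
    xt = X (tgt G e)

  toggle-walk-balance : ∀ μ H F {a b} l → StepWalk G a b l → Unique (map proj₁ l) → AllowedWalk μ H F l →
    ∀ (X : VSet G) → δ⁺ G (toggleWalk F l) X + δ⁻ G F X + tally μ (X a) (X b) ≡
                     δ⁻ G (toggleWalk F l) X + δ⁺ G F X + tally μ (X b) (X a)
  toggle-walk-balance μ H F {a} [] refl _ _ X = cong (_+ tally μ (X a) (X a)) (+-comm (δ⁺ G F X) (δ⁻ G F X))
  toggle-walk-balance μ H F {b = b} ((e , d) ∷ l) (refl , w) (e∉l ∷ u) (ok ∷ oks) X =
    balance-chain (δ⁺ G F X) (δ⁻ G F X) (δ⁺ G F₁ X) (δ⁻ G F₁ X) (δ⁺ G F₂ X) (δ⁻ G F₂ X)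
      (tally μ xa xc) (tally μ xc xa) (tally μ xc xb) (tally μ xb xc) (tally μ xa xb) (tally μ xb xa)
      (toggle-step-balance μ H F e d X ok)
      (toggle-walk-balance μ H F₁ l w u (allowed-after-toggle μ H F e l e∉l oks) X)
      (tally-telescope μ xa xb xc)
    where
    F₁ F₂ : EdgeSet G
    F₁ = toggleEdge F e
    F₂ = toggleWalk F₁ l
    xa xb xc : Bool
    xa = X (from G (e , d))
    xb = X b
    xc = X (to G (e , d))

  augment-⊆ : ∀ H F l → F ⊆ₑ H → Unique (map proj₁ l) → AllowedWalk augmenting H F l → toggleWalk F l ⊆ₑ H
  augment-⊆ H F [] F⊆H _ _ = F⊆H
  augment-⊆ H F ((e , d) ∷ l) F⊆H (e∉l ∷ u) (ok ∷ oks) =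
    augment-⊆ H (toggleEdge F e) l step-⊆ u (allowed-after-toggle augmenting H F e l e∉l oks)
    where
    gained-in-H : ∀ d f h → not f ≡ true → allowed augmenting d h f ≡ true → h ≡ true
    gained-in-H fwd false h _  ok = ok
    gained-in-H bwd false h _  ()
    gained-in-H d   true  h () _
    step-⊆ : toggleEdge F e ⊆ₑ H
    step-⊆ x x∈ with x ≟ e
    ... | no x≢e  = F⊆H x (trans (sym (toggleEdge-other F e x x≢e)) x∈)
    ... | yes refl = gained-in-H d (F x) (H x) (trans (sym (toggleEdge-same F x)) x∈) ok

  delete-⊆ : ∀ H F l → Unique (map proj₁ l) → AllowedWalk supporting H F l → toggleWalk F l ⊆ₑ F
  delete-⊆ H F [] _ _ = λ _ x∈ → x∈
  delete-⊆ H F ((e , d) ∷ l) (e∉l ∷ u) (ok ∷ oks) x x∈ =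
    step-⊆ d ok (delete-⊆ H (toggleEdge F e) l u (allowed-after-toggle supporting H F e l e∉l oks) x x∈)
    where
    step-⊆ : ∀ d → allowed supporting d (H e) (F e) ≡ true → toggleEdge F e x ≡ true → F x ≡ true
    step-⊆ d ok x∈ with x ≟ e
    ... | no x≢e  = trans (sym (toggleEdge-other F e x x≢e)) x∈
    step-⊆ fwd ok x∈ | yes refl = ok

  delete-removes : ∀ H F l → Unique (map proj₁ l) → AllowedWalk supporting H F l →
                   ∀ x → x ∈ map proj₁ l → toggleWalk F l x ≡ false
  delete-removes H F ((e , fwd) ∷ l) (e∉l ∷ u) (Fe ∷ oks) x (here refl) =
    trans (toggleWalk-other (toggleEdge F e) l x (All¬⇒¬Any e∉l))
          (trans (toggleEdge-same F x) (cong not Fe))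
  delete-removes H F ((e , d) ∷ l) (e∉l ∷ u) (ok ∷ oks) x (there x∈l) =
    delete-removes H (toggleEdge F e) l u (allowed-after-toggle supporting H F e l e∉l oks) x x∈l

  supporting-walk : ∀ H F {a b} l → AllowedWalk supporting H F l → StepWalk G a b l →
                    IsWalk G a b (map proj₁ l) × (walkVerts G a (map proj₁ l) ≡ stepVerts G a l) ×
                    All (λ e → F e ≡ true) (map proj₁ l)
  supporting-walk H F []                  []          refl = refl , refl , []
  supporting-walk H F {a} ((e , fwd) ∷ l) (Fe ∷ oks) (from≡a , w) =
    let (walk , same-verts , inF) = supporting-walk H F l oks w
    in (from≡a , walk) , cong (a ∷_) same-verts , Fe ∷ inF

module _ (G : Digraph) (s t : Vertex G) where

  inSupport : EdgeSet G → Step G → Bool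
  inSupport F = Allowed G supporting F F

  SupportPath : EdgeSet G → Set
  SupportPath F = SimpleWalk G (λ st → inSupport F st ≡ true) s t

  -- A flow of positive value has an s,t-path in its support: otherwise the vertices
  -- reachable from s in the support form an s,t-cut that no F-edge leaves.
  support-path : ∀ F j → FlowOf G F s t (suc j) → SupportPath F
  support-path F j flow with closure G (inSupport F) s
  ... | R , Rs , reach , closed with R t in Rt
  ... | true  = let (l , w , oks) = reach t Rt in shortcut G _ l w oks
  ... | false = ⊥-elim (0≢1+n (begin
        0                   ≡⟨ closed-no-exit G (inSupport F) s R closed F (λ _ Fe → Fe) ⟨
        δ⁺ G F R            ≡⟨ flow R Rs Rt ⟩
        δ⁻ G F R + suc j    ≡⟨ +-suc (δ⁻ G F R) j ⟩
        suc (δ⁻ G F R + j)  ∎))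
    where open ≡-Reasoning

  delete-path : ∀ F j → FlowOf G F s t (suc j) → ((l , _) : SupportPath F) → Unique (map proj₁ l) →
                FlowOf G (toggleWalk G F l) s t j
  delete-path F j flow (l , w , _ , oks) unique X Xs Xt
    with toggle-walk-balance G supporting F F l w unique oks X
  ... | balance rewrite Xs | Xt | flow X Xs Xt = +-cancelʳ-≡ (δ⁻ G F X + 1) _ _ (begin
      δ⁺ G F' X + (δ⁻ G F X + 1)        ≡⟨ +-assoc (δ⁺ G F' X) (δ⁻ G F X) 1 ⟨
      δ⁺ G F' X + δ⁻ G F X + 1          ≡⟨ balance ⟩
      δ⁻ G F' X + (δ⁻ G F X + suc j) + 0 ≡⟨ regroup (δ⁻ G F' X) (δ⁻ G F X) j ⟩
      δ⁻ G F' X + j + (δ⁻ G F X + 1)    ∎)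
    where
    open ≡-Reasoning
    F' : EdgeSet G
    F' = toggleWalk G F l
    regroup : ∀ i' i j → i' + (i + suc j) + 0 ≡ i' + j + (i + 1)
    regroup = solve-∀

  decompose : ∀ j F → FlowOf G F s t j → HasEDPaths G F s t j
  decompose zero    F flow = (λ ()) , (λ ()) , (λ ())
  decompose (suc j) F flow with support-path F j flow
  ... | l , w , simple , oks = P , paths , disjoint
    where
    unique : Unique (map proj₁ l)
    unique = simple⇒edges-unique G l w simple
    rest : HasEDPaths G (toggleWalk G F l) s t j
    rest = decompose j (toggleWalk G F l) (delete-path F j flow (l , w , simple , oks) unique)
    P : Fin (suc j) → List (Edge G)
    P zero    = map proj₁ l
    P (suc i) = proj₁ rest i
    paths : ∀ i → IsPathIn G F s t (P i)
    paths zero    = let (walk , same-verts , inF) = supporting-walk G F F l oks w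
                    in walk , subst Unique (sym same-verts) simple , inF
    paths (suc i) = let (walk , uniq , inF') = proj₁ (proj₂ rest) i
                    in walk , uniq , All-map (λ {x} → delete-⊆ G F F l unique oks x) inF'
    -- the first path's edges were deleted before the others were found
    apart : ∀ i e → e ∈ map proj₁ l → e ∈ proj₁ rest i → ⊥
    apart i e e∈l e∈Pi = true≢false (trans (sym (All-lookup (proj₂ (proj₂ (proj₁ (proj₂ rest) i))) e∈Pi))
                                           (delete-removes G F F l unique oks e e∈l))
    disjoint : ∀ i i' → i ≢ i' → (e : Edge G) → e ∈ P i → e ∈ P i' → ⊥
    disjoint zero    zero     i≢i' e _ _     = i≢i' refl
    disjoint zero    (suc i') _    e e∈ e∈'  = apart i' e e∈ e∈'
    disjoint (suc i) zero     _    e e∈ e∈'  = apart i e e∈' e∈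
    disjoint (suc i) (suc i') i≢i' e e∈ e∈' = proj₂ (proj₂ rest) i i' (i≢i' ∘ cong suc) e e∈ e∈'

fewer-paths : ∀ {G : Digraph} {H s t k ℓ} → k ≤ ℓ → HasEDPaths G H s t ℓ → HasEDPaths G H s t k
fewer-paths {k = k} {ℓ} k≤ℓ (P , paths , disjoint) =
  P ∘ embed , paths ∘ embed ,
  λ i i' i≢i' → disjoint (embed i) (embed i') (i≢i' ∘ Finₚ.inject≤-injective k≤ℓ k≤ℓ i i')
  where
  embed : Fin k → Fin ℓ
  embed i = inject≤ i k≤ℓ

MengerWitness : (G : Digraph) → EdgeSet G → Vertex G → Vertex G → Set
MengerWitness G H s t =
  Σ ℕ λ ℓ → HasEDPaths G H s t ℓ × Σ (VSet G) λ X → (X s ≡ true) × (X t ≡ false) × (δ⁺ G H X ≤ ℓ)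

-- An H-edge is either in F or in the part H ∖ F that is traversable forwards in the residual graph.
𝟙-split : ∀ f h x → 𝟙 (h ∧ x) ≤ 𝟙 (f ∧ x) + 𝟙 ((not f ∧ h) ∧ x)
𝟙-split true  true  true  = s≤s z≤n
𝟙-split true  true  false = z≤n
𝟙-split true  false x     = z≤n
𝟙-split false h     x     = ≤-refl

module _ (G : Digraph) (H : EdgeSet G) (s t : Vertex G) (s≢t : s ≢ t) where

  FlowIn : Set
  FlowIn = Σ ℕ λ j → Σ (EdgeSet G) λ F → (_⊆ₑ_ G F H) × FlowOf G F s t j

  -- Flow values are bounded by the number of edges, as the cut {s} shows.
  value≤m : (φ : FlowIn) → proj₁ φ ≤ m G
  value≤m (j , F , _ , flow) = begin
    j                   ≤⟨ m≤n+m j _ ⟩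
    δ⁻ G F source + j   ≡⟨ flow source (≟-true s s refl) t∉source ⟨
    δ⁺ G F source       ≤⟨ count-𝟙≤ (m G) _ ⟩
    m G                 ∎
    where
    open ≤-Reasoning
    source : VSet G
    source x = ⌊ x ≟ s ⌋
    t∉source : source t ≡ false
    t∉source with t ≟ s
    ... | yes t≡s = ⊥-elim (s≢t (sym t≡s))
    ... | no _    = refl

  residual : EdgeSet G → Step G → Bool
  residual F = Allowed G augmenting H F

  augment : ((j , F , _ , _) : FlowIn) → SimpleWalk G (λ st → residual F st ≡ true) s t →
            Σ FlowIn λ φ' → j < proj₁ φ'
  augment (j , F , F⊆H , flow) (l , w , simple , oks) =
    (suc j , toggleWalk G F l , augment-⊆ G H F l F⊆H unique oks , flow') , ≤-refl
    where
    unique : Unique (map proj₁ l)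
    unique = simple⇒edges-unique G l w simple
    F' : EdgeSet G
    F' = toggleWalk G F l
    flow' : FlowOf G F' s t (suc j)
    flow' X Xs Xt with toggle-walk-balance G augmenting H F l w unique oks X
    ... | balance rewrite Xs | Xt | flow X Xs Xt = +-cancelʳ-≡ (δ⁻ G F X) _ _ (begin
        δ⁺ G F' X + δ⁻ G F X               ≡⟨ +-identityʳ _ ⟨
        δ⁺ G F' X + δ⁻ G F X + 0           ≡⟨ balance ⟩
        δ⁻ G F' X + (δ⁻ G F X + j) + 1     ≡⟨ regroup (δ⁻ G F' X) (δ⁻ G F X) j ⟩
        δ⁻ G F' X + suc j + δ⁻ G F X       ∎)
      where
      open ≡-Reasoning
      regroup : ∀ i' i j → i' + (i + j) + 1 ≡ i' + suc j + i
      regroup = solve-∀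

  -- If t is not reachable in the residual graph, the reachable set R is a minimum cut:
  -- every H-edge leaving R carries flow and no flow enters R, so δ⁺ H R ≤ δ⁺ F R = j.
  residual-cut : ((j , F , _ , _) : FlowIn) → ∀ R → R s ≡ true → R t ≡ false →
                 ClosedUnder G (residual F) s R → δ⁺ G H R ≤ j
  residual-cut (j , F , _ , flow) R Rs Rt closed = begin
    δ⁺ G H R                          ≤⟨ count-mono (m G) _ _ (λ e → 𝟙-split (F e) (H e) _) ⟩
    count (m G) (λ e → 𝟙 (leaves G F R e) + 𝟙 (leaves G H∖F R e))
                                      ≡⟨ count-+ (m G) _ _ ⟩
    δ⁺ G F R + δ⁺ G H∖F R             ≡⟨ cong (δ⁺ G F R +_) (closed-no-exit G (residual F) s R closed H∖F (λ _ ok → ok)) ⟩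
    δ⁺ G F R + 0                      ≡⟨ +-identityʳ _ ⟩
    δ⁺ G F R                          ≡⟨ flow R Rs Rt ⟩
    δ⁻ G F R + j                      ≡⟨ cong (_+ j) (closed-no-entry G (residual F) s R closed F (λ _ Fe → Fe)) ⟩
    j                                 ∎
    where
    open ≤-Reasoning
    H∖F : EdgeSet G
    H∖F e = not (F e) ∧ H e

  round : (φ : FlowIn) → MengerWitness G H s t ⊎ Σ FlowIn λ φ' → proj₁ φ < proj₁ φ'
  round φ@(j , F , F⊆H , flow) with closure G (residual F) s
  ... | R , Rs , reach , closed with R t in Rt
  ... | true  = let (l , w , oks) = reach t Rt in inj₂ (augment φ (shortcut G _ l w oks))
  ... | false = inj₁ (j , lift (decompose G s t j F flow) , R , Rs , Rt , residual-cut φ R Rs Rt closed)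
    where
    lift : HasEDPaths G F s t j → HasEDPaths G H s t j
    lift (P , paths , disjoint) =
      P , (λ i → let (walk , uniq , inF) = paths i in walk , uniq , All-map (λ {x} → F⊆H x) inF) , disjoint

  menger : MengerWitness G H s t
  menger = ascend proj₁ (m G) value≤m round (0 , (λ _ → false) , (λ _ ()) , zero-flow)
    where
    zero-flow : FlowOf G (λ _ → false) s t 0
    zero-flow X _ _ = trans (count-zero (m G) _ (λ _ → refl))
                            (sym (trans (+-identityʳ _) (count-zero (m G) _ (λ _ → refl))))

-- Submodularity of cuts: δ⁺ (X ∪ Y) + δ⁺ (X ∩ Y) ≤ δ⁺ X + δ⁺ Y, checked edge by edge
-- (each case is a comparison of numerals, decided by evaluation).
𝟙-submodular : ∀ h xa xb ya yb →
  𝟙 (h ∧ (xa ∨ ya) ∧ not (xb ∨ yb)) + 𝟙 (h ∧ (xa ∧ ya) ∧ not (xb ∧ yb)) ≤ 𝟙 (h ∧ xa ∧ not xb) + 𝟙 (h ∧ ya ∧ not yb)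
𝟙-submodular false _     _     _     _     = z≤n
𝟙-submodular true  true  true  true  true  = ≤ᵇ⇒≤ _ _ tt
𝟙-submodular true  true  true  true  false = ≤ᵇ⇒≤ _ _ tt
𝟙-submodular true  true  true  false true  = ≤ᵇ⇒≤ _ _ tt
𝟙-submodular true  true  true  false false = ≤ᵇ⇒≤ _ _ tt
𝟙-submodular true  true  false true  true  = ≤ᵇ⇒≤ _ _ tt
𝟙-submodular true  true  false true  false = ≤ᵇ⇒≤ _ _ tt
𝟙-submodular true  true  false false true  = ≤ᵇ⇒≤ _ _ tt
𝟙-submodular true  true  false false false = ≤ᵇ⇒≤ _ _ tt
𝟙-submodular true  false true  true  true  = ≤ᵇ⇒≤ _ _ tt
𝟙-submodular true  false true  true  false = ≤ᵇ⇒≤ _ _ tt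
𝟙-submodular true  false true  false true  = ≤ᵇ⇒≤ _ _ tt
𝟙-submodular true  false true  false false = ≤ᵇ⇒≤ _ _ tt
𝟙-submodular true  false false true  true  = ≤ᵇ⇒≤ _ _ tt
𝟙-submodular true  false false true  false = ≤ᵇ⇒≤ _ _ tt
𝟙-submodular true  false false false true  = ≤ᵇ⇒≤ _ _ tt
𝟙-submodular true  false false false false = ≤ᵇ⇒≤ _ _ tt

δ⁺-submodular : (G : Digraph) (H : EdgeSet G) (X Y : VSet G) →
                δ⁺ G H (X ∪ Y) + δ⁺ G H (X ∩ Y) ≤ δ⁺ G H X + δ⁺ G H Y
δ⁺-submodular G H X Y = subst₂ _≤_ (count-+ (m G) _ _) (count-+ (m G) _ _)
  (count-mono (m G) _ _ (λ e → 𝟙-submodular (H e) (X (src G e)) (X (tgt G e)) (Y (src G e)) (Y (tgt G e))))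

intoV : (G : Digraph) → EdgeSet G → Vertex G → Edge G → Bool
intoV G H v e = H e ∧ ⌊ tgt G e ≟ v ⌋

-- Every r,v-path ends with its own H-edge into v, so at most indeg v of them are
-- edge-disjoint (apply weak duality to the cut V ∖ {v}).
paths≤indeg : (G : Digraph) (H : EdgeSet G) (r v : Vertex G) (j : ℕ) → v ≢ r →
              HasEDPaths G H r v j → j ≤ indeg G H v
paths≤indeg G H r v j v≢r paths = ≤-trans (paths≤cut G H avoid-v paths r∈ v∉) (count-mono (m G) _ _ only-into-v)
  where
  avoid-v : VSet G
  avoid-v x = not ⌊ x ≟ v ⌋
  r∈ : avoid-v r ≡ true
  r∈ with r ≟ v
  ... | yes r≡v = ⊥-elim (v≢r (sym r≡v))
  ... | no _    = refl
  v∉ : avoid-v v ≡ false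
  v∉ rewrite ≟-true v v refl = refl
  only-into-v : ∀ e → 𝟙 (leaves G H avoid-v e) ≤ 𝟙 (intoV G H v e)
  only-into-v e with H e | tgt G e ≟ v
  ... | false | _     = z≤n
  ... | true  | yes _ = 𝟙-∧≤ _ _
  ... | true  | no _  = ≤-reflexive (cong 𝟙 (Boolₚ.∧-zeroʳ _))

remove-same : ∀ (G : Digraph) H e → remove G H e e ≡ false
remove-same G H e with e ≟ e
... | yes _   = refl
... | no e≢e = ⊥-elim (e≢e refl)

remove-other : ∀ (G : Digraph) H e e' → e' ≢ e → remove G H e e' ≡ H e'
remove-other G H e e' e'≢e with e ≟ e'
... | yes e≡e' = ⊥-elim (e'≢e (sym e≡e'))
... | no _     = refl

module _ (G : Digraph) (r : Vertex G) (T : Vertex G → Bool) (k : ℕ) (H : EdgeSet G)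
         (feasible : Feasible G r T k H)
         (minimal : (e : Edge G) → H e ≡ true → ¬ Feasible G r T k (remove G H e)) where

  terminal-cut≥k : ∀ t → T t ≡ true → (Y : VSet G) → Y r ≡ true → Y t ≡ false → k ≤ δ⁺ G H Y
  terminal-cut≥k t Tt Y Yr Yt = paths≤cut G H Y (feasible t Tt) Yr Yt

  record TightCut (e : Edge G) : Set where
    field
      terminal   : Vertex G
      isTerminal : T terminal ≡ true
      side       : VSet G
      root∈      : side r ≡ true
      terminal∉  : side terminal ≡ false
      e-leaves   : leaves G H side e ≡ true
      size≤k     : δ⁺ G H side ≤ k

  -- By minimality H ∖ e is infeasible, so by Menger some terminal t is separated from r
  -- in H ∖ e by a cut of size < k.
  deficient-cut : ∀ e → H e ≡ true → Σ (Vertex G) λ t → (T t ≡ true) ×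
                  Σ (VSet G) λ Y → (Y r ≡ true) × (Y t ≡ false) × (δ⁺ G (remove G H e) Y < k)
  deficient-cut e He with fin-dichotomy enough-paths-or-cut
    where
    enough-paths-or-cut : ∀ t → (T t ≡ true → HasEDPaths G (remove G H e) r t k) ⊎
      ((T t ≡ true) × Σ (VSet G) λ Y → (Y r ≡ true) × (Y t ≡ false) × (δ⁺ G (remove G H e) Y < k))
    enough-paths-or-cut t with T t in Tt | t ≟ r
    ... | false | _      = inj₁ (λ ())
    -- the root itself is reached by k empty paths
    ... | true  | yes refl = inj₁ (λ _ → (λ _ → []) , (λ _ → refl , [] ∷ [] , []) , (λ _ _ _ _ ()))
    ... | true  | no t≢r with menger G (remove G H e) r t (t≢r ∘ sym)
    ...   | ℓ , paths , Y , Yr , Yt , Y≤ℓ with k ≤? ℓ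
    ...     | yes k≤ℓ = inj₁ (λ _ → fewer-paths k≤ℓ paths)
    ...     | no  k≰ℓ = inj₂ (refl , Y , Yr , Yt , ≤-<-trans Y≤ℓ (≰⇒> k≰ℓ))
  ... | inj₁ feasible' = ⊥-elim (minimal e He feasible')
  ... | inj₂ found     = found

  remove-cut : ∀ e (Y : VSet G) → δ⁺ G H Y ≡ δ⁺ G (remove G H e) Y + 𝟙 (leaves G H Y e)
  remove-cut e Y = trans (sym (+-identityʳ _))
    (subst (λ c → δ⁺ G H Y + 𝟙 (c ∧ Y (src G e) ∧ not (Y (tgt G e))) ≡ δ⁺ G (remove G H e) Y + 𝟙 (leaves G H Y e))
           (remove-same G H e)
           (count-edit G (remove G H e) H e (λ x c → c ∧ Y (src G x) ∧ not (Y (tgt G x))) (remove-other G H e)))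

  -- Minimality makes every edge of H leave a tight cut: the deficient cut Y of H ∖ e is
  -- left by at least k edges of H, and by at most one more than in H ∖ e — namely by e.
  tight-cut : ∀ e → H e ≡ true → TightCut e
  tight-cut e He with deficient-cut e He
  ... | t , Tt , Y , Yr , Yt , Y<k with leaves G H Y e in e-leaves
  ... | true  = record { terminal = t ; isTerminal = Tt ; side = Y ; root∈ = Yr ; terminal∉ = Yt
                       ; e-leaves = e-leaves ; size≤k = Y≤k }
    where
    open ≤-Reasoning
    Y≤k : δ⁺ G H Y ≤ k
    Y≤k = begin
      δ⁺ G H Y                                      ≡⟨ remove-cut e Y ⟩
      δ⁺ G (remove G H e) Y + 𝟙 (leaves G H Y e)    ≡⟨ cong (λ b → δ⁺ G (remove G H e) Y + 𝟙 b) e-leaves ⟩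
      δ⁺ G (remove G H e) Y + 1                     ≡⟨ +-comm _ 1 ⟩
      suc (δ⁺ G (remove G H e) Y)                   ≤⟨ Y<k ⟩
      k                                             ∎
  ... | false = ⊥-elim (<⇒≱ Y<k (begin
      k                                             ≤⟨ terminal-cut≥k t Tt Y Yr Yt ⟩
      δ⁺ G H Y                                      ≡⟨ remove-cut e Y ⟩
      δ⁺ G (remove G H e) Y + 𝟙 (leaves G H Y e)    ≡⟨ cong (λ b → δ⁺ G (remove G H e) Y + 𝟙 b) e-leaves ⟩
      δ⁺ G (remove G H e) Y + 0                     ≡⟨ +-identityʳ _ ⟩
      δ⁺ G (remove G H e) Y                         ∎))
    where open ≤-Reasoning

  -- Uncrossing: if X contains r and δ⁺ H X ≤ ℓ, then also δ⁺ H (X ∪ Y) ≤ ℓ for a tight cut Y,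
  -- since X ∩ Y still separates r from Y's terminal and so is left by at least k edges.
  uncross : ∀ {e ℓ} (X : VSet G) → X r ≡ true → δ⁺ G H X ≤ ℓ → (Y : TightCut e) →
            δ⁺ G H (X ∪ TightCut.side Y) ≤ ℓ
  uncross {ℓ = ℓ} X Xr X≤ℓ Y = +-cancelʳ-≤ k _ _ (begin
    δ⁺ G H (X ∪ S) + k              ≤⟨ +-monoʳ-≤ (δ⁺ G H (X ∪ S)) (terminal-cut≥k terminal isTerminal (X ∩ S) r∈X∩S t∉X∩S) ⟩
    δ⁺ G H (X ∪ S) + δ⁺ G H (X ∩ S) ≤⟨ δ⁺-submodular G H X S ⟩
    δ⁺ G H X + δ⁺ G H S             ≤⟨ +-mono-≤ X≤ℓ size≤k ⟩
    ℓ + k                           ∎)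
    where
    open TightCut Y renaming (side to S)
    open ≤-Reasoning
    r∈X∩S : (X ∩ S) r ≡ true
    r∈X∩S rewrite Xr | root∈ = refl
    t∉X∩S : (X ∩ S) terminal ≡ false
    t∉X∩S rewrite terminal∉ = Boolₚ.∧-zeroʳ (X terminal)

  -- Starting from any cut X ∋ r, X ∌ v with δ⁺ H X ≤ ℓ, uncross with tight cuts through
  -- the H-edges entering v from outside X until there are none; then every H-edge into v
  -- leaves X, so indeg v ≤ δ⁺ H X ≤ ℓ.  The sets grow strictly, so this terminates.
  indeg≤cut : ∀ v ℓ (X : VSet G) → X r ≡ true → X v ≡ false → δ⁺ G H X ≤ ℓ → indeg G H v ≤ ℓ
  indeg≤cut v ℓ X Xr Xv X≤ℓ = ascend (size G ∘ proj₁) (n G) (size≤n G ∘ proj₁) enlarge (X , Xr , Xv , X≤ℓ)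
    where
    Cut : Set
    Cut = Σ (VSet G) λ X → (X r ≡ true) × (X v ≡ false) × (δ⁺ G H X ≤ ℓ)

    from-outside : VSet G → Edge G → Bool
    from-outside X e = H e ∧ ⌊ tgt G e ≟ v ⌋ ∧ not (X (src G e))

    enlarge : (C : Cut) → indeg G H v ≤ ℓ ⊎ Σ Cut λ C' → size G (proj₁ C) < size G (proj₁ C')
    enlarge (X , Xr , Xv , X≤ℓ) with search (from-outside X)
    ... | inj₁ none = inj₁ (≤-trans (count-mono (m G) _ _ into-v-leaves) X≤ℓ)
      where
      into-v-leaves : ∀ e → 𝟙 (intoV G H v e) ≤ 𝟙 (leaves G H X e)
      into-v-leaves e with H e | tgt G e ≟ v | none e
      ... | false | _        | _ = z≤n
      ... | true  | no _     | _ = z≤n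
      ... | true  | yes refl | outside rewrite Xv with X (src G e)
      ...   | true = ≤-refl
      ...   | false with outside
      ...     | ()
    ... | inj₂ (e , e-from-outside) with crossing⁻ (H e) (⌊ tgt G e ≟ v ⌋) (X (src G e)) e-from-outside
    ...   | He , into-v , src∉X =
          inj₂ ((X ∪ S , Xr' , Xv' , uncross X Xr X≤ℓ Y) , size-∪-grows G X S (src G e) src∉X src∈S)
      where
      Y : TightCut e
      Y = tight-cut e He
      open TightCut Y renaming (side to S)
      e-crosses : (H e ≡ true) × (S (src G e) ≡ true) × (S (tgt G e) ≡ false)
      e-crosses = crossing⁻ (H e) (S (src G e)) (S (tgt G e)) e-leaves
      src∈S : S (src G e) ≡ true
      src∈S = proj₁ (proj₂ e-crosses)
      Xr' : (X ∪ S) r ≡ true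
      Xr' rewrite Xr = refl
      Sv : S v ≡ false
      Sv = subst (λ w → S w ≡ false) (≟-true⁻ _ _ into-v) (proj₂ (proj₂ e-crosses))
      Xv' : (X ∪ S) v ≡ false
      Xv' = cong₂ _∨_ Xv Sv

lemma4 : (G : Digraph) (c : Edge G → ℕ) (r : Vertex G) (T : Vertex G → Bool) (k : ℕ) →
         1 ≤ k → (H : EdgeSet G) → Minimal G r T k H →
         (v : Vertex G) → InV G H v → v ≢ r →
         IsMaxEDPaths G H r v (indeg G H v)
lemma4 G _ r T k _ H (feasible , minimal) v _ v≢r with menger G H r v (v≢r ∘ sym)
... | ℓ , paths , X , Xr , Xv , X≤ℓ =
  subst (HasEDPaths G H r v) ℓ≡indeg paths , λ j → paths≤indeg G H r v j v≢r
  where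
  ℓ≡indeg : ℓ ≡ indeg G H v
  ℓ≡indeg = ≤-antisym (paths≤indeg G H r v ℓ v≢r paths) (indeg≤cut G r T k H feasible minimal v ℓ X Xr Xv X≤ℓ)
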